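{- For each positive integer $n$, there is a set $P\subset[0,1]^2$ of $2n$ points in general position that avoids $321$ and such that every Manhattan network of $P$ has total length at least $n$.
   Context: A finite point set is in general position if no two points share an $x$- or $y$-coordinate; it avoids $321$ if, listing its points by increasing $x$-coordinate, there are no three points with strictly decreasing $y$-coordinates. A Manhattan network of $P$ is a finite collection $N$ of axis-parallel line segments such that every pair of points of $P$ is connected by a path that is monotone in both coordinates and contained in the union of the segments of $N$; its length is the total length of the segments in $N$.
   Formalization: The points of P are taken in ℚ², and the length bound covers only Manhattan networks whose segments have rational endpoints. -}

module Defs where

open import Data.Nat using (ℕ)
open import Data.Integer using (+_)
open import Data.Rational using (ℚ; _≤_; _<_; _+_; _-_; ∣_∣; _/_; 0ℚ; 1ℚ; _⊔_; _⊓_)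
open import Data.Product using (_×_; _,_; proj₁; proj₂; Σ)
open import Data.Sum using (_⊎_)
open import Data.List using (List; foldr; length)
open import Data.List.Membership.Propositional using (_∈_)
open import Data.List.Relation.Unary.All using (All)
open import Data.List.Relation.Unary.AllPairs using (AllPairs)
open import Relation.Binary.PropositionalEquality using (_≡_; _≢_)
open import Relation.Nullary using (¬_)

Point : Set
Point = ℚ × ℚ

xc : Point → ℚ
xc = proj₁

yc : Point → ℚ
yc = proj₂

ℕtoℚ : ℕ → ℚ
ℕtoℚ n = + n / 1

InUnitSquare : Point → Set
InUnitSquare p = (0ℚ ≤ xc p × xc p ≤ 1ℚ) × (0ℚ ≤ yc p × yc p ≤ 1ℚ)

GeneralPosition : List Point → Set
GeneralPosition = AllPairs (λ p q → (xc p ≢ xc q) × (yc p ≢ yc q))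

Avoids321 : List Point → Set
Avoids321 P = ∀ {a b c} → a ∈ P → b ∈ P → c ∈ P →
  ¬ ((xc a < xc b × xc b < xc c) × (yc b < yc a × yc c < yc b))

record Segment : Set where
  constructor seg
  field
    s t : Point
    axisParallel : (xc s ≡ xc t) ⊎ (yc s ≡ yc t)
open Segment public

segLength : Segment → ℚ
segLength σ = ∣ xc (s σ) - xc (t σ) ∣ + ∣ yc (s σ) - yc (t σ) ∣

OnSeg : Point → Segment → Set
OnSeg u σ =
  ((xc (s σ) ⊓ xc (t σ)) ≤ xc u × xc u ≤ (xc (s σ) ⊔ xc (t σ))) ×
  ((yc (s σ) ⊓ yc (t σ)) ≤ yc u × yc u ≤ (yc (s σ) ⊔ yc (t σ)))

Network : Set
Network = List Segment

networkLength : Network → ℚ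
networkLength = foldr (λ σ acc → segLength σ + acc) 0ℚ

-- the straight segment from u to v is contained in a single segment of N
-- (both endpoints on a segment suffices by convexity)
Step : Network → Point → Point → Set
Step N u v = Σ Segment λ σ → σ ∈ N × OnSeg u σ × OnSeg v σ

MonotoneStep : Point → Point → Point → Point → Set
MonotoneStep p q u v =
  ((xc p ≤ xc q → xc u ≤ xc v) × (xc q ≤ xc p → xc v ≤ xc u)) ×
  ((yc p ≤ yc q → yc u ≤ yc v) × (yc q ≤ yc p → yc v ≤ yc u))

data MonPath (N : Network) (p q : Point) : Point → Point → Set where
  here : ∀ {u} → MonPath N p q u u
  step : ∀ {u v w} → Step N u v → MonotoneStep p q u v →
         MonPath N p q v w → MonPath N p q u w

Connects : Network → Point → Point → Set
Connects N p q = MonPath N p q p q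

IsManhattanNetwork : Network → List Point → Set
IsManhattanNetwork N P = ∀ {p q} → p ∈ P → q ∈ P → Connects N p q

{-# OPTIONS --safe #-}
-- The set consists of n + 1 pairs: an upper point (2k/(2n+1), (g+k)/(n+1)²) and a lower
-- point ((2k+1)/(2n+1), k/(n+1)²) for k ≤ n, where g = n² + n + 1.  The upper points form an
-- increasing chain and so do the lower points, hence no pattern 321.  A monotone path from
-- the k-th upper to the k-th lower point descends by g/(n+1)² inside the vertical strip
-- spanned by their x-coordinates; these strips are disjoint and a y-monotone path covers
-- each height only once, so the vertical segments have total length at least
-- (n+1)g/(n+1)².  A monotone path from the last lower to the first upper point crosses the
-- whole width, so the horizontal segments have length at least 1.  Finally
-- 1 + (n+1)g/(n+1)² ≥ n + 1 because n² ≤ g.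
module Submission where

open import Defs
open import Data.Nat using (ℕ; suc; _*_)
open import Data.Rational using (_≤_)
open import Data.Product using (_×_; Σ)
open import Data.List using (List; length)
open import Data.List.Relation.Unary.All using (All)
open import Relation.Binary.PropositionalEquality using (_≡_)

open import Data.Empty using (⊥-elim)
import Data.Integer as ℤ
import Data.Integer.Properties as ℤ
open import Data.Integer.Solver using (module +-*-Solver)
open import Data.List using ([]; _∷_; _++_; foldr; map; applyUpTo)
open import Data.List.Membership.Propositional using (_∈_)
open import Data.List.Membership.Propositional.Properties
  using (∈-++⁺ˡ; ∈-++⁺ʳ; ∈-++⁻; ∈-applyUpTo⁺; ∈-applyUpTo⁻; ∈-map⁺)
open import Data.List.Properties using (length-++; length-applyUpTo)
open import Data.List.Relation.Unary.All as All using ([]; _∷_)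
import Data.List.Relation.Unary.All.Properties as All
open import Data.List.Relation.Unary.AllPairs as AllPairs using (AllPairs; []; _∷_)
import Data.List.Relation.Unary.AllPairs.Properties as AllPairs
open import Data.List.Relation.Unary.Any using (here; there)
open import Data.Nat as ℕ using (z≤n; s≤s; _∸_)
import Data.Nat.Properties as ℕ
open import Data.Product using (_,_; proj₁; proj₂)
open import Data.Rational using (ℚ; _/_; _<_; _+_; _-_; -_; ∣_∣; 0ℚ; 1ℚ; _⊔_; _⊓_; toℚᵘ)
open import Data.Rational.Properties
open import Data.Rational.Solver using (module +-*-Solver)
import Data.Rational.Unnormalised as ℚᵘ
import Data.Rational.Unnormalised.Properties as ℚᵘ
open import Data.Sum using (inj₁; inj₂)
import Data.Sum as Sum
open import Relation.Binary.Definitions using (tri<; tri≈; tri>)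
open import Relation.Binary.PropositionalEquality
  using (_≢_; refl; sym; trans; cong; cong₂; subst; subst₂; module ≡-Reasoning)
open import Relation.Nullary using (Dec; yes; no; ¬_)
open import Relation.Nullary.Decidable using (_×-dec_)

module ℚ-Solver = Data.Rational.Solver.+-*-Solver
module ℤ-Solver = Data.Integer.Solver.+-*-Solver

p≤q⇒0≤q-p : ∀ {p q} → p ≤ q → 0ℚ ≤ q - p
p≤q⇒0≤q-p {p} {q} p≤q = subst (_≤ q - p) (+-inverseʳ p) (+-monoˡ-≤ (- p) p≤q)

p≤q⇒p-q≤0 : ∀ {p q} → p ≤ q → p - q ≤ 0ℚ
p≤q⇒p-q≤0 {p} {q} p≤q = subst (p - q ≤_) (+-inverseʳ q) (+-monoˡ-≤ (- q) p≤q)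

p≤∣p∣ : ∀ p → p ≤ ∣ p ∣
p≤∣p∣ p with ≤-total 0ℚ p
... | inj₁ 0≤p = ≤-reflexive (sym (0≤p⇒∣p∣≡p 0≤p))
... | inj₂ p≤0 = ≤-trans p≤0 (0≤∣p∣ p)

-[p-q]≡q-p : ∀ p q → - (p - q) ≡ q - p
-[p-q]≡q-p = solve 2 (λ p q → :- (p :- q) := q :- p) refl
  where open ℚ-Solver

p⊔q-p⊓q≤∣p-q∣ : ∀ p q → (p ⊔ q) - (p ⊓ q) ≤ ∣ p - q ∣
p⊔q-p⊓q≤∣p-q∣ p q with ≤-total p q
... | inj₁ p≤q rewrite p≤q⇒p⊔q≡q p≤q | p≤q⇒p⊓q≡p p≤q =
  subst₂ _≤_ (-[p-q]≡q-p p q) (∣-p∣≡∣p∣ (p - q)) (p≤∣p∣ (- (p - q)))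
... | inj₂ q≤p rewrite p≥q⇒p⊔q≡p q≤p | p≥q⇒p⊓q≡q q≤p = p≤∣p∣ (p - q)

telescope : ∀ a b c → (b - a) + (c - b) ≡ c - a
telescope = solve 3 (λ a b c → (b :- a) :+ (c :- b) := c :- a) refl
  where open ℚ-Solver

p⊓p≤r≤p⊔p⇒r≡p : ∀ {p r} → p ⊓ p ≤ r → r ≤ p ⊔ p → r ≡ p
p⊓p≤r≤p⊔p⇒r≡p {p} lo hi =
  ≤-antisym (subst (_ ≤_) (⊔-idem p) hi) (subst (_≤ _) (⊓-idem p) lo)

-- Fractions with a fixed positive denominator

-- Opaque, so that unification never unfolds the normalising division.
opaque
  frac : ℕ → ℕ → ℚ
  frac d a = ℤ.+ a / suc d

opaque
  unfolding frac

  toℚᵘ-frac : ∀ d a → toℚᵘ (frac d a) ℚᵘ.≃ ℚᵘ.mkℚᵘ (ℤ.+ a) d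
  toℚᵘ-frac d a = toℚᵘ-fromℚᵘ (ℚᵘ.mkℚᵘ (ℤ.+ a) d)

  ℕtoℚ≡frac : ∀ n → ℕtoℚ n ≡ frac 0 n
  ℕtoℚ≡frac n = refl

frac-≤ : ∀ {d e a b} → a ℕ.* suc e ℕ.≤ b ℕ.* suc d → frac d a ≤ frac e b
frac-≤ {d} {e} {a} {b} le = toℚᵘ-cancel-≤
  (ℚᵘ.≤-respʳ-≃ (ℚᵘ.≃-sym (toℚᵘ-frac e b)) (ℚᵘ.≤-respˡ-≃ (ℚᵘ.≃-sym (toℚᵘ-frac d a))
    (ℚᵘ.*≤* (subst₂ ℤ._≤_ (ℤ.pos-* a (suc e)) (ℤ.pos-* b (suc d)) (ℤ.+≤+ le)))))

frac-< : ∀ {d e a b} → a ℕ.* suc e ℕ.< b ℕ.* suc d → frac d a < frac e b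
frac-< {d} {e} {a} {b} lt = toℚᵘ-cancel-<
  (ℚᵘ.<-respʳ-≃ (ℚᵘ.≃-sym (toℚᵘ-frac e b)) (ℚᵘ.<-respˡ-≃ (ℚᵘ.≃-sym (toℚᵘ-frac d a))
    (ℚᵘ.*<* (subst₂ ℤ._<_ (ℤ.pos-* a (suc e)) (ℤ.pos-* b (suc d)) (ℤ.+<+ lt)))))

frac-≡ : ∀ {d e a b} → a ℕ.* suc e ≡ b ℕ.* suc d → frac d a ≡ frac e b
frac-≡ {d} {e} {a} {b} eq = toℚᵘ-injective
  (ℚᵘ.≃-trans (toℚᵘ-frac d a) (ℚᵘ.≃-trans
    (ℚᵘ.*≡* (trans (sym (ℤ.pos-* a (suc e))) (trans (cong ℤ.+_ eq) (ℤ.pos-* b (suc d)))))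
    (ℚᵘ.≃-sym (toℚᵘ-frac e b))))

frac-+ : ∀ d a b → frac d a + frac d b ≡ frac d (a ℕ.+ b)
frac-+ d a b = toℚᵘ-injective (begin-equality
  toℚᵘ (frac d a + frac d b)                 ≃⟨ toℚᵘ-homo-+ (frac d a) (frac d b) ⟩
  toℚᵘ (frac d a) ℚᵘ.+ toℚᵘ (frac d b)       ≃⟨ ℚᵘ.+-cong (toℚᵘ-frac d a) (toℚᵘ-frac d b) ⟩
  ℚᵘ.mkℚᵘ (ℤ.+ a) d ℚᵘ.+ ℚᵘ.mkℚᵘ (ℤ.+ b) d   ≃⟨ ℚᵘ.*≡* cross ⟩
  ℚᵘ.mkℚᵘ (ℤ.+ (a ℕ.+ b)) d                  ≃⟨ ℚᵘ.≃-sym (toℚᵘ-frac d (a ℕ.+ b)) ⟩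
  toℚᵘ (frac d (a ℕ.+ b))                    ∎)
  where
  open ℚᵘ.≤-Reasoning
  open ℤ-Solver
  D : ℤ.ℤ
  D = ℤ.+ suc d
  cross : (ℤ.+ a ℤ.* D ℤ.+ ℤ.+ b ℤ.* D) ℤ.* D ≡ ℤ.+ (a ℕ.+ b) ℤ.* (D ℤ.* D)
  cross = trans (solve 3 (λ a b d → (a :* d :+ b :* d) :* d := (a :+ b) :* (d :* d)) refl
                       (ℤ.+ a) (ℤ.+ b) D)
                (cong₂ ℤ._*_ (sym (ℤ.pos-+ a b)) (sym (ℤ.pos-* (suc d) (suc d))))

frac-mono-≤ : ∀ d {a b} → a ℕ.≤ b → frac d a ≤ frac d b
frac-mono-≤ d le = frac-≤ (ℕ.*-monoˡ-≤ (suc d) le)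

frac-mono-< : ∀ d {a b} → a ℕ.< b → frac d a < frac d b
frac-mono-< d lt = frac-< (ℕ.*-monoˡ-< (suc d) lt)

frac-injective : ∀ d {a b} → frac d a ≡ frac d b → a ≡ b
frac-injective d {a} {b} eq with ℕ.<-cmp a b
... | tri< a<b _ _ = ⊥-elim (<⇒≢ (frac-mono-< d a<b) eq)
... | tri≈ _ a≡b _ = a≡b
... | tri> _ _ b<a = ⊥-elim (<⇒≢ (frac-mono-< d b<a) (sym eq))

frac-zero : ∀ d → frac d 0 ≡ 0ℚ
frac-zero d = trans (frac-≡ refl) (sym (ℕtoℚ≡frac 0))

frac-one : ∀ d → frac d (suc d) ≡ 1ℚ
frac-one d = trans (frac-≡ (ℕ.*-comm (suc d) 1)) (sym (ℕtoℚ≡frac 1))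

0≤frac : ∀ d a → 0ℚ ≤ frac d a
0≤frac d a = subst (_≤ frac d a) (frac-zero d) (frac-mono-≤ d z≤n)

frac≤1 : ∀ d {a} → a ℕ.≤ suc d → frac d a ≤ 1ℚ
frac≤1 d le = subst (frac d _ ≤_) (frac-one d) (frac-mono-≤ d le)

frac-∸ : ∀ d {a b} → a ℕ.≤ b → frac d b - frac d a ≡ frac d (b ∸ a)
frac-∸ d {a} {b} a≤b = begin
  frac d b - frac d a                      ≡⟨ cong (λ z → frac d z - frac d a) (ℕ.m∸n+n≡m a≤b) ⟨
  frac d (b ∸ a ℕ.+ a) - frac d a          ≡⟨ cong (_- frac d a) (frac-+ d (b ∸ a) a) ⟨
  (frac d (b ∸ a) + frac d a) - frac d a   ≡⟨ [p+q]-q≡p (frac d (b ∸ a)) (frac d a) ⟩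
  frac d (b ∸ a)                           ∎
  where
  open ≡-Reasoning
  [p+q]-q≡p : ∀ p q → (p + q) - q ≡ p
  [p+q]-q≡p = solve 2 (λ p q → (p :+ q) :- q := p) refl
    where open ℚ-Solver

-- Finite sums of rationals

private variable A B : Set

-- A right fold, so that networkLength N is definitionally ∑ N segLength.
∑ : List A → (A → ℚ) → ℚ
∑ xs f = foldr (λ x acc → f x + acc) 0ℚ xs

∑-zero : ∀ (xs : List A) → ∑ xs (λ _ → 0ℚ) ≡ 0ℚ
∑-zero []       = refl
∑-zero (x ∷ xs) = trans (+-identityˡ _) (∑-zero xs)

∑-mono : ∀ {f g : A → ℚ} {xs} → All (λ x → f x ≤ g x) xs → ∑ xs f ≤ ∑ xs g
∑-mono []           = ≤-refl
∑-mono (fx≤gx ∷ le) = +-mono-≤ fx≤gx (∑-mono le)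

∑-nonneg : ∀ {f : A → ℚ} xs → (∀ x → 0ℚ ≤ f x) → 0ℚ ≤ ∑ xs f
∑-nonneg {f = f} xs 0≤f = subst (_≤ ∑ xs f) (∑-zero xs) (∑-mono (All.universal 0≤f xs))

∑-+ : ∀ (f g : A → ℚ) xs → ∑ xs f + ∑ xs g ≡ ∑ xs (λ x → f x + g x)
∑-+ f g []       = +-identityˡ 0ℚ
∑-+ f g (x ∷ xs) =
  trans (interchange (f x) (∑ xs f) (g x) (∑ xs g)) (cong (_+_ (f x + g x)) (∑-+ f g xs))
  where
  interchange : ∀ a b c d → (a + b) + (c + d) ≡ (a + c) + (b + d)
  interchange = solve 4 (λ a b c d → (a :+ b) :+ (c :+ d) := (a :+ c) :+ (b :+ d)) refl
    where open ℚ-Solver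

∑-∈ : ∀ {f : A → ℚ} {x xs} → (∀ x → 0ℚ ≤ f x) → x ∈ xs → f x ≤ ∑ xs f
∑-∈ {f = f} {xs = x ∷ xs} 0≤f (here refl) =
  subst (_≤ ∑ (x ∷ xs) f) (+-identityʳ (f x)) (+-monoʳ-≤ (f x) (∑-nonneg xs 0≤f))
∑-∈ {f = f} {x} {y ∷ xs} 0≤f (there x∈xs) =
  subst (_≤ ∑ (y ∷ xs) f) (+-identityˡ (f x)) (+-mono-≤ (0≤f y) (∑-∈ 0≤f x∈xs))

∑-comm : ∀ (f : A → B → ℚ) xs ys →
         ∑ xs (λ x → ∑ ys (f x)) ≡ ∑ ys (λ y → ∑ xs (λ x → f x y))
∑-comm f []       ys = sym (∑-zero ys)
∑-comm f (x ∷ xs) ys = trans (cong (∑ ys (f x) +_) (∑-comm f xs ys)) (∑-+ (f x) _ ys)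

∑-map : ∀ (f : B → ℚ) (g : A → B) xs → ∑ (map g xs) f ≡ ∑ xs (λ x → f (g x))
∑-map f g []       = refl
∑-map f g (x ∷ xs) = cong (f (g x) +_) (∑-map f g xs)

∑-frac : ∀ d a (xs : List A) → ∑ xs (λ _ → frac d a) ≡ frac d (length xs ℕ.* a)
∑-frac d a []       = sym (frac-zero d)
∑-frac d a (x ∷ xs) = trans (cong (frac d a +_) (∑-frac d a xs)) (frac-+ d a _)

when : {P : Set} → Dec P → ℚ → ℚ
when (yes _) q = q
when (no _)  _ = 0ℚ

module _ {P : Set} where

  when-yes : ∀ (P? : Dec P) {q} → P → when P? q ≡ q
  when-yes (yes _) _  = refl
  when-yes (no ¬p) p = ⊥-elim (¬p p)

  when-no : ∀ (P? : Dec P) {q} → ¬ P → when P? q ≡ 0ℚ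
  when-no (yes p) ¬p = ⊥-elim (¬p p)
  when-no (no _)  _  = refl

  when-nonneg : ∀ (P? : Dec P) {q} → 0ℚ ≤ q → 0ℚ ≤ when P? q
  when-nonneg (yes _) 0≤q = 0≤q
  when-nonneg (no _)  _   = ≤-refl

  when-≤ : ∀ (P? : Dec P) {q} → 0ℚ ≤ q → when P? q ≤ q
  when-≤ (yes _) _   = ≤-refl
  when-≤ (no _)  0≤q = 0≤q

  when-mono : ∀ (P? : Dec P) {q r} → q ≤ r → when P? q ≤ when P? r
  when-mono (yes _) q≤r = q≤r
  when-mono (no _)  _   = ≤-refl

  when-superadditive : ∀ (P? : Dec P) {q r s} → q + r ≤ s → when P? q + when P? r ≤ when P? s
  when-superadditive (yes _) le = le
  when-superadditive (no _)  _  = ≤-refl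

overlapLength : ℚ → ℚ → ℚ → ℚ → ℚ
overlapLength a b m M = ((b ⊓ M) - (a ⊔ m)) ⊔ 0ℚ

overlapLength-nonneg : ∀ a b m M → 0ℚ ≤ overlapLength a b m M
overlapLength-nonneg a b m M = p≤q⊔p ((b ⊓ M) - (a ⊔ m)) 0ℚ

overlapLength≤ : ∀ a b {m M} → m ≤ M → overlapLength a b m M ≤ M - m
overlapLength≤ a b {m} {M} m≤M =
  ⊔-lub (+-mono-≤ (p⊓q≤q b M) (neg-antimono-≤ (p≤q⊔p a m))) (p≤q⇒0≤q-p m≤M)

overlapLength-⊇ : ∀ {a b m M} → m ≤ a → b ≤ M → b - a ≤ overlapLength a b m M
overlapLength-⊇ {a} {b} m≤a b≤M rewrite p≤q⇒p⊓q≡p b≤M | p≥q⇒p⊔q≡p m≤a = p≤p⊔q (b - a) 0ℚ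

overlapLength-superadditive : ∀ {a b c m M} → m ≤ M → a ≤ b → b ≤ c →
                              overlapLength a b m M + overlapLength b c m M ≤ overlapLength a c m M
overlapLength-superadditive {a} {b} {c} {m} {M} m≤M a≤b b≤c with ≤-total b m
... | inj₁ b≤m
  rewrite p≤q⇒p⊔q≡q b≤m | p≤q⇒p⊔q≡q (≤-trans a≤b b≤m)
        | p≤q⇒p⊔q≡q (p≤q⇒p-q≤0 (≤-trans (p⊓q≤p b M) b≤m))
  = ≤-reflexive (+-identityˡ _)
... | inj₂ m≤b with ≤-total M b
...   | inj₁ M≤b
  rewrite p≥q⇒p⊓q≡q M≤b | p≥q⇒p⊓q≡q (≤-trans M≤b b≤c)
        | p≤q⇒p⊔q≡q (p≤q⇒p-q≤0 (≤-trans M≤b (p≤p⊔q b m)))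
  = ≤-reflexive (+-identityʳ _)
...   | inj₂ b≤M
  rewrite p≤q⇒p⊓q≡p b≤M | p≥q⇒p⊔q≡p m≤b
        | p≥q⇒p⊔q≡p (p≤q⇒0≤q-p (⊔-lub a≤b m≤b)) | p≥q⇒p⊔q≡p (p≤q⇒0≤q-p (⊓-glb b≤c b≤M))
  = ≤-trans (≤-reflexive (telescope (a ⊔ m) b (c ⊓ M))) (p≤p⊔q _ 0ℚ)

-- Lengths of networks and of their parts inside vertical strips

dx dy : Segment → ℚ
dx σ = ∣ xc (s σ) - xc (t σ) ∣
dy σ = ∣ yc (s σ) - yc (t σ) ∣

horizontalLength verticalLength : Network → ℚ
horizontalLength N = ∑ N dx
verticalLength   N = ∑ N dy

networkLength≡horizontal+vertical : ∀ N → networkLength N ≡ horizontalLength N + verticalLength N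
networkLength≡horizontal+vertical N = sym (∑-+ dx dy N)

yOverlapLength : ℚ → ℚ → Segment → ℚ
yOverlapLength a b σ = overlapLength a b (yc (s σ) ⊓ yc (t σ)) (yc (s σ) ⊔ yc (t σ))

yOverlapLength≤dy : ∀ a b σ → yOverlapLength a b σ ≤ dy σ
yOverlapLength≤dy a b σ =
  ≤-trans (overlapLength≤ a b (p⊓q≤p⊔q (yc (s σ)) (yc (t σ)))) (p⊔q-p⊓q≤∣p-q∣ (yc (s σ)) (yc (t σ)))

onSeg-x : ∀ {u} σ → xc (s σ) ≡ xc (t σ) → OnSeg u σ → xc u ≡ xc (s σ)
onSeg-x (seg _ _ _) refl ((lo , hi) , _) = p⊓p≤r≤p⊔p⇒r≡p lo hi

onSeg-y : ∀ {u} σ → yc (s σ) ≡ yc (t σ) → OnSeg u σ → yc u ≡ yc (s σ)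
onSeg-y (seg _ _ _) refl (_ , (lo , hi)) = p⊓p≤r≤p⊔p⇒r≡p lo hi

Strip : Set
Strip = ℚ × ℚ

InStrip : Strip → ℚ → Set
InStrip (l , r) x = l ≤ x × x ≤ r

inStrip? : ∀ I x → Dec (InStrip I x)
inStrip? (l , r) x = (l ≤? x) ×-dec (x ≤? r)

_≺_ : Strip → Strip → Set
(_ , r) ≺ (l , _) = r < l

-- A segment is counted in a strip when its endpoint s is; for vertical segments, the only
-- ones with dy ≠ 0, this means the whole segment lies in the strip.
stripLength : Strip → Network → ℚ
stripLength I N = ∑ N λ σ → when (inStrip? I (xc (s σ))) (dy σ)

clippedDy : Strip → ℚ → ℚ → Segment → ℚ
clippedDy I a b σ = when (inStrip? I (xc (s σ))) (yOverlapLength a b σ)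

clippedDy-nonneg : ∀ I a b σ → 0ℚ ≤ clippedDy I a b σ
clippedDy-nonneg I a b σ = when-nonneg (inStrip? I (xc (s σ)))
  (overlapLength-nonneg a b (yc (s σ) ⊓ yc (t σ)) (yc (s σ) ⊔ yc (t σ)))

clippedStripLength : Strip → ℚ → ℚ → Network → ℚ
clippedStripLength I a b N = ∑ N (clippedDy I a b)

clippedStripLength-nonneg : ∀ I a b N → 0ℚ ≤ clippedStripLength I a b N
clippedStripLength-nonneg I a b N = ∑-nonneg N (clippedDy-nonneg I a b)

clippedStripLength-superadditive : ∀ I {a b c} N → a ≤ b → b ≤ c →
  clippedStripLength I a b N + clippedStripLength I b c N ≤ clippedStripLength I a c N
clippedStripLength-superadditive I {a} {b} {c} N a≤b b≤c =
  ≤-trans (≤-reflexive (∑-+ (clippedDy I a b) (clippedDy I b c) N))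
          (∑-mono (All.universal superadditive N))
  where
  superadditive : ∀ σ → clippedDy I a b σ + clippedDy I b c σ ≤ clippedDy I a c σ
  superadditive σ = when-superadditive (inStrip? I (xc (s σ)))
    (overlapLength-superadditive (p⊓q≤p⊔q (yc (s σ)) (yc (t σ))) a≤b b≤c)

clippedStripLength≤stripLength : ∀ I a b N → clippedStripLength I a b N ≤ stripLength I N
clippedStripLength≤stripLength I a b N =
  ∑-mono (All.universal (λ σ → when-mono (inStrip? I (xc (s σ))) (yOverlapLength≤dy a b σ)) N)

stripLength≤verticalLength : ∀ I N → stripLength I N ≤ verticalLength N
stripLength≤verticalLength I N =
  ∑-mono (All.universal (λ σ → when-≤ (inStrip? I (xc (s σ))) (0≤∣p∣ _)) N)

∑-when-¬ : ∀ {P : A → Set} (P? : ∀ x → Dec (P x)) {xs} d →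
           All (λ x → ¬ P x) xs → ∑ xs (λ x → when (P? x) d) ≡ 0ℚ
∑-when-¬ P? d []         = refl
∑-when-¬ P? d (¬px ∷ ¬P) = trans (cong₂ _+_ (when-no (P? _) ¬px) (∑-when-¬ P? d ¬P)) (+-identityˡ 0ℚ)

∑-when-inStrip≤ : ∀ {Is} x {d} → AllPairs _≺_ Is → 0ℚ ≤ d → ∑ Is (λ I → when (inStrip? I x) d) ≤ d
∑-when-inStrip≤ x []         0≤d = 0≤d
∑-when-inStrip≤ {I ∷ Is} x {d} (I≺Is ∷ Is-sorted) 0≤d with inStrip? I x
... | yes (_ , x≤r) = ≤-reflexive (trans (cong (d +_) rest≡0) (+-identityʳ d))
  where
  outside : ∀ {J} → I ≺ J → ¬ InStrip J x
  outside r<l (l≤x , _) = <-irrefl refl (<-≤-trans (≤-<-trans x≤r r<l) l≤x)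
  rest≡0 : ∑ Is (λ J → when (inStrip? J x) d) ≡ 0ℚ
  rest≡0 = ∑-when-¬ (λ J → inStrip? J x) d (All.map outside I≺Is)
... | no _ = subst (_≤ d) (sym (+-identityˡ _)) (∑-when-inStrip≤ x Is-sorted 0≤d)

stripLengths≤verticalLength : ∀ {Is} N → AllPairs _≺_ Is →
                              ∑ Is (λ I → stripLength I N) ≤ verticalLength N
stripLengths≤verticalLength {Is} N sorted =
  ≤-trans (≤-reflexive (∑-comm (λ I σ → when (inStrip? I (xc (s σ))) (dy σ)) Is N))
          (∑-mono (All.universal (λ σ → ∑-when-inStrip≤ (xc (s σ)) sorted (0≤∣p∣ _)) N))

-- Monotone paths

path-xc-≤ : ∀ {N p q u w} → MonPath N p q u w → xc p ≤ xc q → xc u ≤ xc w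
path-xc-≤ here               _     = ≤-refl
path-xc-≤ (step _ mono rest) xp≤xq = ≤-trans (proj₁ (proj₁ mono) xp≤xq) (path-xc-≤ rest xp≤xq)

path-yc-≥ : ∀ {N p q u w} → MonPath N p q u w → yc q ≤ yc p → yc w ≤ yc u
path-yc-≥ here               _     = ≤-refl
path-yc-≥ (step _ mono rest) yq≤yp = ≤-trans (path-yc-≥ rest yq≤yp) (proj₂ (proj₂ mono) yq≤yp)

step-drop≤clippedDy : ∀ I {u v} σ → InStrip I (xc u) → OnSeg u σ → OnSeg v σ → yc v ≤ yc u →
                      yc u - yc v ≤ clippedDy I (yc v) (yc u) σ
step-drop≤clippedDy I σ@(seg _ _ (inj₁ vertical)) u∈I u∈σ v∈σ _ =
  subst (_ ≤_) (sym (when-yes (inStrip? I (xc (s σ))) (subst (InStrip I) (onSeg-x σ vertical u∈σ) u∈I)))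
        (overlapLength-⊇ (proj₁ (proj₂ v∈σ)) (proj₂ (proj₂ u∈σ)))
step-drop≤clippedDy I {u} {v} σ@(seg _ _ (inj₂ horizontal)) _ u∈σ v∈σ _ =
  subst (_≤ clippedDy I (yc v) (yc u) σ) (sym yu-yv≡0) (clippedDy-nonneg I (yc v) (yc u) σ)
  where
  yu-yv≡0 : yc u - yc v ≡ 0ℚ
  yu-yv≡0 = trans (cong (_- yc v) (trans (onSeg-y σ horizontal u∈σ) (sym (onSeg-y σ horizontal v∈σ))))
                  (+-inverseʳ (yc v))

-- A path may run along the same segment several times, but the heights covered by its
-- steps are disjoint; measuring every segment only on the heights [a , b] still to be
-- covered makes the bound additive along the path.
drop≤clippedStripLength : ∀ {N p q u w l r} → MonPath N p q u w → xc p ≤ xc q → yc q ≤ yc p →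
                          l ≤ xc u → xc w ≤ r → yc u - yc w ≤ clippedStripLength (l , r) (yc w) (yc u) N
drop≤clippedStripLength {N} {u = u} {l = l} {r} here _ _ _ _ =
  subst (_≤ clippedStripLength (l , r) (yc u) (yc u) N) (sym (+-inverseʳ (yc u)))
        (clippedStripLength-nonneg (l , r) (yc u) (yc u) N)
drop≤clippedStripLength {N} {u = u} {w} {l} {r} (step {v = v} (σ , σ∈N , u∈σ , v∈σ) mono rest)
                        xp≤xq yq≤yp l≤xu xw≤r = begin
  yc u - yc w                       ≡⟨ telescope (yc w) (yc v) (yc u) ⟨
  (yc v - yc w) + (yc u - yc v)     ≤⟨ +-mono-≤ restDrop stepDrop ⟩
  clip (yc w) (yc v) + clip (yc v) (yc u)
                                    ≤⟨ clippedStripLength-superadditive (l , r) N yw≤yv yv≤yu ⟩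
  clip (yc w) (yc u)                ∎
  where
  open ≤-Reasoning
  clip : ℚ → ℚ → ℚ
  clip a b = clippedStripLength (l , r) a b N
  xu≤xv : xc u ≤ xc v
  xu≤xv = proj₁ (proj₁ mono) xp≤xq
  yv≤yu : yc v ≤ yc u
  yv≤yu = proj₂ (proj₂ mono) yq≤yp
  yw≤yv : yc w ≤ yc v
  yw≤yv = path-yc-≥ rest yq≤yp
  xu∈strip : InStrip (l , r) (xc u)
  xu∈strip = l≤xu , ≤-trans xu≤xv (≤-trans (path-xc-≤ rest xp≤xq) xw≤r)
  restDrop : yc v - yc w ≤ clip (yc w) (yc v)
  restDrop = drop≤clippedStripLength rest xp≤xq yq≤yp (≤-trans l≤xu xu≤xv) xw≤r
  stepDrop : yc u - yc v ≤ clip (yc v) (yc u)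
  stepDrop = ≤-trans (step-drop≤clippedDy (l , r) σ xu∈strip u∈σ v∈σ yv≤yu)
                     (∑-∈ (clippedDy-nonneg (l , r) (yc v) (yc u)) σ∈N)

drop≤stripLength : ∀ {N p q u w l r} → MonPath N p q u w → xc p ≤ xc q → yc q ≤ yc p →
                   l ≤ xc u → xc w ≤ r → yc u - yc w ≤ stripLength (l , r) N
drop≤stripLength {N} {u = u} {w} {l} {r} π xp≤xq yq≤yp l≤xu xw≤r =
  ≤-trans (drop≤clippedStripLength π xp≤xq yq≤yp l≤xu xw≤r)
          (clippedStripLength≤stripLength (l , r) (yc w) (yc u) N)

drop≤verticalLength : ∀ {N p q u w} → MonPath N p q u w → xc p ≤ xc q → yc q ≤ yc p →
                      yc u - yc w ≤ verticalLength N
drop≤verticalLength {N} {u = u} {w} π xp≤xq yq≤yp =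
  ≤-trans (drop≤stripLength π xp≤xq yq≤yp ≤-refl ≤-refl) (stripLength≤verticalLength (xc u , xc w) N)

swapPoint : Point → Point
swapPoint u = yc u , xc u

swapSegment : Segment → Segment
swapSegment σ = seg (swapPoint (s σ)) (swapPoint (t σ)) (Sum.swap (axisParallel σ))

swapPath : ∀ {N p q u w} → MonPath N p q u w →
           MonPath (map swapSegment N) (swapPoint p) (swapPoint q) (swapPoint u) (swapPoint w)
swapPath here = here
swapPath (step (σ , σ∈N , (ux , uy) , (vx , vy)) (mx , my) rest) =
  step (swapSegment σ , ∈-map⁺ swapSegment σ∈N , (uy , ux) , (vy , vx)) (my , mx) (swapPath rest)

xDrop≤horizontalLength : ∀ {N p q u w} → MonPath N p q u w → xc q ≤ xc p → yc p ≤ yc q →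
                         xc u - xc w ≤ horizontalLength N
xDrop≤horizontalLength {N} π xq≤xp yp≤yq =
  subst (_ ≤_) (∑-map dy swapSegment N) (drop≤verticalLength (swapPath π) yp≤yq xq≤xp)

-- Point sets built from increasing sequences

Apart : Point → Point → Set
Apart p q = (xc p ≢ xc q) × (yc p ≢ yc q)

IncreasingChain : List Point → Set
IncreasingChain C = ∀ {a b} → a ∈ C → b ∈ C → xc a < xc b → yc a < yc b

StrictlyIncreasing : (ℕ → Point) → Set
StrictlyIncreasing f = ∀ {i j} → i ℕ.< j → xc (f i) < xc (f j) × yc (f i) < yc (f j)

twoChains⇒Avoids321 : ∀ {C₁ C₂} → IncreasingChain C₁ → IncreasingChain C₂ → Avoids321 (C₁ ++ C₂)
twoChains⇒Avoids321 {C₁} inc₁ inc₂ a∈ b∈ c∈ ((xa<xb , xb<xc) , (yb<ya , yc<yb))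
  with ∈-++⁻ C₁ a∈ | ∈-++⁻ C₁ b∈ | ∈-++⁻ C₁ c∈
... | inj₁ a | inj₁ b | _      = <-asym (inc₁ a b xa<xb) yb<ya
... | inj₂ a | inj₂ b | _      = <-asym (inc₂ a b xa<xb) yb<ya
... | _      | inj₁ b | inj₁ c = <-asym (inc₁ b c xb<xc) yc<yb
... | _      | inj₂ b | inj₂ c = <-asym (inc₂ b c xb<xc) yc<yb
... | inj₁ a | inj₂ _ | inj₁ c = <-asym (inc₁ a c (<-trans xa<xb xb<xc)) (<-trans yc<yb yb<ya)
... | inj₂ a | inj₁ _ | inj₂ c = <-asym (inc₂ a c (<-trans xa<xb xb<xc)) (<-trans yc<yb yb<ya)

applyUpTo-increasingChain : ∀ {f} → StrictlyIncreasing f → ∀ m → IncreasingChain (applyUpTo f m)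
applyUpTo-increasingChain {f} inc m a∈ b∈ xa<xb
  with ∈-applyUpTo⁻ f a∈ | ∈-applyUpTo⁻ f b∈
... | i , _ , refl | j , _ , refl with ℕ.<-cmp i j
...   | tri< i<j _ _ = proj₂ (inc i<j)
...   | tri≈ _ refl _ = ⊥-elim (<-irrefl refl xa<xb)
...   | tri> _ _ j<i = ⊥-elim (<-asym xa<xb (proj₁ (inc j<i)))

applyUpTo-generalPosition : ∀ {f} → StrictlyIncreasing f → ∀ m → GeneralPosition (applyUpTo f m)
applyUpTo-generalPosition {f} inc m = AllPairs.applyUpTo⁺₁ f m λ i<j _ →
  <⇒≢ (proj₁ (inc i<j)) , <⇒≢ (proj₂ (inc i<j))

-- The point set

module Construction (n : ℕ) where

  gap : ℕ
  gap = suc (n * n ℕ.+ n)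

  n<gap : n ℕ.< gap
  n<gap = s≤s (ℕ.m≤n+m n (n * n))

  x y : ℕ → ℚ
  x = frac (2 * n)
  y = frac (n * n ℕ.+ n ℕ.+ n)

  upper lower : ℕ → Point
  upper k = x (2 * k) , y (gap ℕ.+ k)
  lower k = x (suc (2 * k)) , y k

  uppers lowers P : List Point
  uppers = applyUpTo upper (suc n)
  lowers = applyUpTo lower (suc n)
  P = uppers ++ lowers

  strip : ℕ → Strip
  strip k = xc (upper k) , xc (lower k)

  strips : List Strip
  strips = applyUpTo strip (suc n)

  length-P : length P ≡ 2 * suc n
  length-P = begin
    length (uppers ++ lowers)          ≡⟨ length-++ uppers ⟩
    length uppers ℕ.+ length lowers    ≡⟨ cong₂ ℕ._+_ (length-applyUpTo upper (suc n))
                                                      (length-applyUpTo lower (suc n)) ⟩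
    suc n ℕ.+ suc n                    ≡⟨ cong (suc n ℕ.+_) (ℕ.+-identityʳ (suc n)) ⟨
    2 * suc n                          ∎
    where open ≡-Reasoning

  upper-increasing : StrictlyIncreasing upper
  upper-increasing i<j = frac-mono-< (2 * n) (ℕ.*-monoʳ-< 2 i<j) , frac-mono-< _ (ℕ.+-monoʳ-< gap i<j)

  lower-increasing : StrictlyIncreasing lower
  lower-increasing i<j = frac-mono-< (2 * n) (s≤s (ℕ.*-monoʳ-< 2 i<j)) , frac-mono-< _ i<j

  upper∈unitSquare : ∀ {k} → k ℕ.< suc n → InUnitSquare (upper k)
  upper∈unitSquare (s≤s k≤n) =
    (0≤frac _ _ , frac≤1 _ (ℕ.m≤n⇒m≤1+n (ℕ.*-monoʳ-≤ 2 k≤n))) ,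
    (0≤frac _ _ , frac≤1 _ (s≤s (ℕ.+-monoʳ-≤ (n * n ℕ.+ n) k≤n)))

  lower∈unitSquare : ∀ {k} → k ℕ.< suc n → InUnitSquare (lower k)
  lower∈unitSquare (s≤s k≤n) =
    (0≤frac _ _ , frac≤1 _ (s≤s (ℕ.*-monoʳ-≤ 2 k≤n))) ,
    (0≤frac _ _ , frac≤1 _ (ℕ.m≤n⇒m≤1+n (ℕ.≤-trans k≤n (ℕ.m≤n+m n (n * n ℕ.+ n)))))

  P-inUnitSquare : All InUnitSquare P
  P-inUnitSquare = All.++⁺ (All.applyUpTo⁺₁ upper (suc n) upper∈unitSquare)
                           (All.applyUpTo⁺₁ lower (suc n) lower∈unitSquare)

  upper-lower-apart : ∀ {i j} → j ℕ.< suc n → Apart (upper i) (lower j)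
  upper-lower-apart {i} {j} (s≤s j≤n) =
    (λ eq → ℕ.even≢odd i j (frac-injective (2 * n) eq)) ,
    (λ eq → ℕ.<⇒≢ (ℕ.≤-<-trans j≤n (ℕ.<-≤-trans n<gap (ℕ.m≤m+n gap i))) (sym (frac-injective _ eq)))

  P-generalPosition : GeneralPosition P
  P-generalPosition = AllPairs.++⁺
    (applyUpTo-generalPosition upper-increasing (suc n))
    (applyUpTo-generalPosition lower-increasing (suc n))
    (All.applyUpTo⁺₁ upper (suc n) λ _ → All.applyUpTo⁺₁ lower (suc n) upper-lower-apart)

  P-avoids321 : Avoids321 P
  P-avoids321 = twoChains⇒Avoids321 (applyUpTo-increasingChain upper-increasing (suc n))
                                    (applyUpTo-increasingChain lower-increasing (suc n))

  bound : ℚ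
  bound = 1ℚ + y (suc n * gap)

  strips-sorted : AllPairs _≺_ strips
  strips-sorted = AllPairs.applyUpTo⁺₁ strip (suc n) λ {i} {j} i<j _ →
    frac-mono-< (2 * n) (subst (ℕ._≤ 2 * j) (ℕ.*-suc 2 i) (ℕ.*-monoʳ-≤ 2 i<j))

  module _ {N : Network} (manhattan : IsManhattanNetwork N P) where

    upper∈P : ∀ {k} → k ℕ.< suc n → upper k ∈ P
    upper∈P k<1+n = ∈-++⁺ˡ (∈-applyUpTo⁺ upper k<1+n)

    lower∈P : ∀ {k} → k ℕ.< suc n → lower k ∈ P
    lower∈P k<1+n = ∈-++⁺ʳ uppers (∈-applyUpTo⁺ lower k<1+n)

    1≤horizontalLength : 1ℚ ≤ horizontalLength N
    1≤horizontalLength = subst (_≤ horizontalLength N) width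
      (xDrop≤horizontalLength (manhattan (lower∈P ℕ.≤-refl) (upper∈P (s≤s z≤n)))
        (frac-mono-≤ (2 * n) z≤n)
        (frac-mono-≤ _ (ℕ.<⇒≤ (ℕ.<-≤-trans n<gap (ℕ.m≤m+n gap 0)))))
      where
      width : x (suc (2 * n)) - x 0 ≡ 1ℚ
      width = trans (frac-∸ (2 * n) z≤n) (frac-one (2 * n))

    gap≤stripLength : ∀ {k} → k ℕ.< suc n → y gap ≤ stripLength (strip k) N
    gap≤stripLength {k} k<1+n = subst (_≤ stripLength (strip k) N) height
      (drop≤stripLength (manhattan (upper∈P k<1+n) (lower∈P k<1+n))
        (frac-mono-≤ (2 * n) (ℕ.n≤1+n (2 * k)))
        (frac-mono-≤ _ (ℕ.m≤n+m k gap))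
        ≤-refl ≤-refl)
      where
      height : y (gap ℕ.+ k) - y k ≡ y gap
      height = trans (frac-∸ _ (ℕ.m≤n+m k gap)) (cong y (ℕ.m+n∸n≡m gap k))

    [1+n]gap≤verticalLength : y (suc n * gap) ≤ verticalLength N
    [1+n]gap≤verticalLength = begin
      y (suc n * gap)                      ≡⟨ cong (λ m → y (m * gap)) (length-applyUpTo strip (suc n)) ⟨
      y (length strips * gap)              ≡⟨ ∑-frac _ gap strips ⟨
      ∑ strips (λ _ → y gap)               ≤⟨ ∑-mono {g = λ I → stripLength I N}
                                                     (All.applyUpTo⁺₁ strip (suc n) gap≤stripLength) ⟩
      ∑ strips (λ I → stripLength I N)     ≤⟨ stripLengths≤verticalLength N strips-sorted ⟩
      verticalLength N                     ∎
      where open ≤-Reasoning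

    bound≤networkLength : bound ≤ networkLength N
    bound≤networkLength = subst (bound ≤_) (sym (networkLength≡horizontal+vertical N))
                                (+-mono-≤ 1≤horizontalLength [1+n]gap≤verticalLength)

  n[gap+n]≤[1+n]gap : n * (gap ℕ.+ n) ℕ.≤ suc n * gap * 1
  n[gap+n]≤[1+n]gap = begin
    n * (gap ℕ.+ n)           ≡⟨ ℕ.*-distribˡ-+ n gap n ⟩
    n * gap ℕ.+ n * n         ≤⟨ ℕ.+-monoʳ-≤ (n * gap) (ℕ.≤-trans (ℕ.m≤m+n (n * n) n) (ℕ.n≤1+n _)) ⟩
    n * gap ℕ.+ gap           ≡⟨ ℕ.+-comm (n * gap) gap ⟩
    suc n * gap               ≡⟨ ℕ.*-identityʳ (suc n * gap) ⟨
    suc n * gap * 1           ∎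
    where open ℕ.≤-Reasoning

  1+n≤bound : ℕtoℚ (suc n) ≤ bound
  1+n≤bound = begin
    ℕtoℚ (suc n)            ≡⟨ ℕtoℚ≡frac (suc n) ⟩
    frac 0 (1 ℕ.+ n)        ≡⟨ frac-+ 0 1 n ⟨
    frac 0 1 + frac 0 n     ≡⟨ cong (_+ frac 0 n) (frac-one 0) ⟩
    1ℚ + frac 0 n           ≤⟨ +-monoʳ-≤ 1ℚ (frac-≤ n[gap+n]≤[1+n]gap) ⟩
    bound                   ∎
    where open ≤-Reasoning

mainTheorem14 : (n : ℕ) → Σ (List Point) λ P →
    (length P ≡ 2 * suc n) × All InUnitSquare P × GeneralPosition P × Avoids321 P ×
    ((N : Network) → IsManhattanNetwork N P → ℕtoℚ (suc n) ≤ networkLength N)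
mainTheorem14 n =
  P , length-P , P-inUnitSquare , P-generalPosition , P-avoids321 ,
  λ N manhattan → ≤-trans 1+n≤bound (bound≤networkLength manhattan)
  where open Construction n
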